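{- For any set $\mathbf{SL}$ of Scott-Lemmon axioms, the axiomatic extension $\mathbf{SKt}+\mathbf{AxSL}$ and the structural extension $\mathbf{SKt}+\mathbf{SL}$ are equivalent.
   Context: Formulae are in negation normal form over $a,\neg a,\lor,\land,\square,\blacksquare,\lozenge,\lozenge^{\bullet}$, where $\lozenge^{\bullet}$ is the past diamond (dual of $\blacksquare$), $\overline A$ is the nnf of $\neg A$. $\mathbf{SKt}$ is the shallow nested sequent calculus for tense logic (rules $id$, $cut$, $\land$, $\lor$, $ctr$, $wk$, residuation $rf$: from $\Gamma,\circ\{\Delta\}$ infer $\bullet\{\Gamma\},\Delta$, and $rp$: from $\Gamma,\bullet\{\Delta\}$ infer $\circ\{\Gamma\},\Delta$, and introduction rules for $\square,\blacksquare,\lozenge,\lozenge^{\bullet}$ at the top level). A Scott-Lemmon axiom is $G(h,i,j,k): \lozenge^h\square^i A\to\square^j\lozenge^k A$, equivalently (over $\mathbf{SKt}$) its primitive form $P(h,i,j,k): (\lozenge^{\bullet})^h\lozenge^j A\to\lozenge^i(\lozenge^{\bullet})^k A$. $\mathbf{SKt}+\mathbf{AxSL}$ adds, for each axiom $F\to G$ in $\mathbf{SL}$, the premise-free rule $\overline F, G$. $\mathbf{SKt}+\mathbf{SL}$ instead adds, for each $P(h,i,j,k)$, the structural rule $sl(h,i,j,k)$: from $\Gamma,\circ^i\{\bullet^k\{\Delta\}\}$ infer $\Gamma,\bullet^h\{\circ^j\{\Delta\}\}$, where $\circ^n\{\Delta\}$ denotes $n$ nested $\circ$-structures around $\Delta$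 (similarly $\bullet^n$). -}

module Defs where

open import Data.Nat using (ℕ; zero; suc)
open import Data.List using (List; []; _∷_; _++_; [_])
open import Data.List.Relation.Binary.Permutation.Propositional using (_↭_)

-- Formulae of tense logic in negation normal form (atoms indexed by ℕ).
data Fm : Set where
  atom  : ℕ → Fm
  natom : ℕ → Fm
  _∨̇_   : Fm → Fm → Fm
  _∧̇_   : Fm → Fm → Fm
  □     : Fm → Fm          -- future box
  ■     : Fm → Fm          -- past box
  ◇     : Fm → Fm
  ◆     : Fm → Fm

neg : Fm → Fm
neg (atom a)  = natom a
neg (natom a) = atom a
neg (A ∨̇ B)   = neg A ∧̇ neg B
neg (A ∧̇ B)   = neg A ∨̇ neg B
neg (□ A)     = ◇ (neg A)
neg (■ A)     = ◆ (neg A)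
neg (◇ A)     = □ (neg A)
neg (◆ A)     = ■ (neg A)

iter : ℕ → (Fm → Fm) → Fm → Fm
iter zero    f A = A
iter (suc n) f A = f (iter n f A)

-- Shallow nested sequents: lists (multisets, up to the exchange rule below)
-- of formulae and nested structures ∘{Δ} (wh) and •{Δ} (bl).
data Item : Set where
  fm : Fm → Item
  wh : List Item → Item
  bl : List Item → Item

Seq : Set
Seq = List Item

circⁿ : ℕ → Seq → Seq
circⁿ zero    Δ = Δ
circⁿ (suc n) Δ = [ wh (circⁿ n Δ) ]

bulⁿ : ℕ → Seq → Seq
bulⁿ zero    Δ = Δ
bulⁿ (suc n) Δ = [ bl (bulⁿ n Δ) ]

-- A set of Scott-Lemmon axioms, given by the set of their parameters (h,i,j,k).
SLSet : Set₁
SLSet = ℕ → ℕ → ℕ → ℕ → Set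

-- An extension of SKt: premise-free rules (Ax) and one-premise structural rules (SR prem concl).
record Ext : Set₁ where
  field
    Ax : Seq → Set
    SR : Seq → Seq → Set
open Ext public

data _⊢_ (E : Ext) : Seq → Set where
  exch : ∀ {Γ Δ} → Γ ↭ Δ → E ⊢ Γ → E ⊢ Δ          -- sequents are multisets
  id   : ∀ Γ a → E ⊢ (Γ ++ fm (atom a) ∷ fm (natom a) ∷ [])
  cut  : ∀ {Γ} A → E ⊢ (Γ ++ [ fm A ]) → E ⊢ (Γ ++ [ fm (neg A) ]) → E ⊢ Γ
  ∧r   : ∀ {Γ A B} → E ⊢ (Γ ++ [ fm A ]) → E ⊢ (Γ ++ [ fm B ]) → E ⊢ (Γ ++ [ fm (A ∧̇ B) ])
  ∨r   : ∀ {Γ A B} → E ⊢ (Γ ++ fm A ∷ fm B ∷ []) → E ⊢ (Γ ++ [ fm (A ∨̇ B) ])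
  ctr  : ∀ {Γ Δ} → E ⊢ (Γ ++ Δ ++ Δ) → E ⊢ (Γ ++ Δ)
  wk   : ∀ {Γ Δ} → E ⊢ Γ → E ⊢ (Γ ++ Δ)
  rf   : ∀ {Γ Δ} → E ⊢ (Γ ++ [ wh Δ ]) → E ⊢ (bl Γ ∷ Δ)
  rp   : ∀ {Γ Δ} → E ⊢ (Γ ++ [ bl Δ ]) → E ⊢ (wh Γ ∷ Δ)
  □r   : ∀ {Γ A} → E ⊢ (Γ ++ [ wh [ fm A ] ]) → E ⊢ (Γ ++ [ fm (□ A) ])
  ■r   : ∀ {Γ A} → E ⊢ (Γ ++ [ bl [ fm A ] ]) → E ⊢ (Γ ++ [ fm (■ A) ])
  ◇r   : ∀ {Γ Δ A} → E ⊢ (Γ ++ [ wh (Δ ++ [ fm A ]) ])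
                   → E ⊢ (Γ ++ wh Δ ∷ fm (◇ A) ∷ [])
  ◆r   : ∀ {Γ Δ A} → E ⊢ (Γ ++ [ bl (Δ ++ [ fm A ]) ])
                   → E ⊢ (Γ ++ bl Δ ∷ fm (◆ A) ∷ [])
  ax   : ∀ {Γ} → Ax E Γ → E ⊢ Γ
  str  : ∀ {Γ Δ} → SR E Γ Δ → E ⊢ Γ → E ⊢ Δ

-- Axiom instances of G(h,i,j,k): ◇ʰ□ⁱA → □ʲ◇ᵏA, as premise-free rules  \overline F, G.
data AxSLRule (SL : SLSet) : Seq → Set where
  axG : ∀ {h i j k} → SL h i j k → (A : Fm) →
        AxSLRule SL (fm (neg (iter h ◇ (iter i □ A))) ∷ fm (iter j □ (iter k ◇ A)) ∷ [])

data NoRule : Seq → Seq → Set where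

data NoAx : Seq → Set where

data SLRule (SL : SLSet) : Seq → Seq → Set where
  sl : ∀ {h i j k} → SL h i j k → (Γ Δ : Seq) →
       SLRule SL (Γ ++ circⁿ i (bulⁿ k Δ)) (Γ ++ bulⁿ h (circⁿ j Δ))

SKt+AxSL : SLSet → Ext
SKt+AxSL SL = record { Ax = AxSLRule SL ; SR = NoRule }

SKt+SL : SLSet → Ext
SKt+SL SL = record { Ax = NoAx ; SR = SLRule SL }

-- Both directions are rule-by-rule simulations.
--
-- In SKt+SL every instance of G(h,i,j,k) is derivable: from the identity
-- on A one builds  ◇ⁱ¬A, ∘ⁱ{•ᵏ{◇ᵏA}},  the rule sl(h,i,j,k) turns it into
-- ◇ⁱ¬A, •ʰ{∘ʲ{◇ᵏA}},  and reading the structures back as modalities (and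
-- using the adjunction between □ʰ and ■ʰ) gives  □ʰ◇ⁱ¬A, □ʲ◇ᵏA.
--
-- In SKt+AxSL every rule sl(h,i,j,k) is admissible: the context Δ is packed
-- into one formula D, the axiom G(h,i,j,k) at ■ᵏD yields its primitive form
-- ◇ⁱ◆ᵏ¬D, ■ʰ□ʲD  (through ◇ᵏ■ᵏD → D and the same adjunction), and a cut
-- on □ⁱ■ᵏD performs the rule.
--
-- Residuation displays every nested position of a sequent at top level, so
-- all logical reasoning may be done deep inside structures; and since SKt is
-- symmetric under exchanging future and past, each lemma about structures is
-- proved once for both tenses.

module Submission where

open import Defs
open import Data.Nat using (ℕ; zero; suc)
open import Data.List using ([]; _∷_; _++_; [_])
open import Data.Product using (_×_; _,_)
open import Data.List.Relation.Binary.Permutation.Propositional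
  using (_↭_; ↭-refl; ↭-prep; ↭-swap; ↭-sym; ↭-trans)
open import Data.List.Relation.Binary.Permutation.Propositional.Properties
  using (++⁺ˡ; ++-comm; ++-assoc; ++-identityʳ; ∷↭∷ʳ)
open import Relation.Binary.PropositionalEquality using (_≡_; refl; sym; trans; cong; subst)

data Tense : Set where
  future past : Tense

converse : Tense → Tense
converse future = past
converse past   = future

nest : Tense → Seq → Item
nest future = wh
nest past   = bl

box dia : Tense → Fm → Fm
box future = □
box past   = ■
dia future = ◇
dia past   = ◆

nestⁿ : Tense → ℕ → Seq → Seq
nestⁿ t zero    Δ = Δ
nestⁿ t (suc n) Δ = [ nest t (nestⁿ t n Δ) ]

nestⁿ-nest : ∀ t n Δ → nestⁿ t n [ nest t Δ ] ≡ [ nest t (nestⁿ t n Δ) ]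
nestⁿ-nest t zero    Δ = refl
nestⁿ-nest t (suc n) Δ = cong (λ Θ → [ nest t Θ ]) (nestⁿ-nest t n Δ)

nestⁿ-future : ∀ n Δ → nestⁿ future n Δ ≡ circⁿ n Δ
nestⁿ-future zero    Δ = refl
nestⁿ-future (suc n) Δ = cong (λ Θ → [ wh Θ ]) (nestⁿ-future n Δ)

nestⁿ-past : ∀ n Δ → nestⁿ past n Δ ≡ bulⁿ n Δ
nestⁿ-past zero    Δ = refl
nestⁿ-past (suc n) Δ = cong (λ Θ → [ bl Θ ]) (nestⁿ-past n Δ)

circⁿ-bulⁿ : ∀ i k Δ → nestⁿ future i (nestⁿ past k Δ) ≡ circⁿ i (bulⁿ k Δ)
circⁿ-bulⁿ i k Δ = trans (nestⁿ-future i _) (cong (circⁿ i) (nestⁿ-past k Δ))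

bulⁿ-circⁿ : ∀ h j Δ → nestⁿ past h (nestⁿ future j Δ) ≡ bulⁿ h (circⁿ j Δ)
bulⁿ-circⁿ h j Δ = trans (nestⁿ-past h _) (cong (bulⁿ h) (nestⁿ-future j Δ))

neg-box : ∀ t A → neg (box t A) ≡ dia t (neg A)
neg-box future A = refl
neg-box past   A = refl

neg-dia : ∀ t A → neg (dia t A) ≡ box t (neg A)
neg-dia future A = refl
neg-dia past   A = refl

neg-iter : ∀ {f g : Fm → Fm} → (∀ A → neg (f A) ≡ g (neg A)) →
           ∀ n A → neg (iter n f A) ≡ iter n g (neg A)
neg-iter         f-g zero    A = refl
neg-iter {g = g} f-g (suc n) A = trans (f-g _) (cong g (neg-iter f-g n A))

neg-iter² : ∀ {f f′ g g′ : Fm → Fm} →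
            (∀ A → neg (f A) ≡ f′ (neg A)) → (∀ A → neg (g A) ≡ g′ (neg A)) →
            ∀ m n A → neg (iter m f (iter n g A)) ≡ iter m f′ (iter n g′ (neg A))
neg-iter² {f′ = f′} f-f′ g-g′ m n A =
  trans (neg-iter f-f′ m _) (cong (iter m f′) (neg-iter g-g′ n A))

⟦_⟧  : Seq → Fm
⟦_⟧ᵢ : Item → Fm
⟦ [] ⟧     = atom 0 ∧̇ natom 0
⟦ x ∷ xs ⟧ = ⟦ x ⟧ᵢ ∨̇ ⟦ xs ⟧
⟦ fm A ⟧ᵢ = A
⟦ wh Δ ⟧ᵢ = □ ⟦ Δ ⟧
⟦ bl Δ ⟧ᵢ = ■ ⟦ Δ ⟧

shift-last : ∀ (Γ : Seq) x Δ → Γ ++ x ∷ Δ ↭ (Γ ++ Δ) ++ [ x ]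
shift-last Γ x Δ = ↭-trans (++⁺ˡ Γ (∷↭∷ʳ x Δ)) (↭-sym (++-assoc Γ Δ [ x ]))

swap-last : ∀ (Γ : Seq) x y → (Γ ++ [ x ]) ++ [ y ] ↭ (Γ ++ [ y ]) ++ [ x ]
swap-last Γ x y = ↭-trans (++-assoc Γ [ x ] [ y ])
                    (↭-trans (++⁺ˡ Γ (↭-swap x y ↭-refl)) (↭-sym (++-assoc Γ [ y ] [ x ])))

simulate : ∀ {E E′ : Ext} →
           (∀ {Γ} → Ax E Γ → E′ ⊢ Γ) →
           (∀ {Γ Δ} → SR E Γ Δ → E′ ⊢ Γ → E′ ⊢ Δ) →
           ∀ {Γ} → E ⊢ Γ → E′ ⊢ Γ
simulate ax′ sr′ (exch π d) = exch π (simulate ax′ sr′ d)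
simulate ax′ sr′ (id Γ a) = id Γ a
simulate ax′ sr′ (cut A d e) = cut A (simulate ax′ sr′ d) (simulate ax′ sr′ e)
simulate ax′ sr′ (∧r d e) = ∧r (simulate ax′ sr′ d) (simulate ax′ sr′ e)
simulate ax′ sr′ (∨r d) = ∨r (simulate ax′ sr′ d)
simulate ax′ sr′ (ctr {Γ} {Δ} d) = ctr {Γ = Γ} {Δ = Δ} (simulate ax′ sr′ d)
simulate ax′ sr′ (wk {Δ = Δ} d) = wk {Δ = Δ} (simulate ax′ sr′ d)
simulate ax′ sr′ (rf {Γ} d) = rf {Γ = Γ} (simulate ax′ sr′ d)
simulate ax′ sr′ (rp {Γ} d) = rp {Γ = Γ} (simulate ax′ sr′ d)
simulate ax′ sr′ (□r d) = □r (simulate ax′ sr′ d)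
simulate ax′ sr′ (■r d) = ■r (simulate ax′ sr′ d)
simulate ax′ sr′ (◇r d) = ◇r (simulate ax′ sr′ d)
simulate ax′ sr′ (◆r d) = ◆r (simulate ax′ sr′ d)
simulate ax′ sr′ (ax a) = ax′ a
simulate ax′ sr′ (str r d) = sr′ r (simulate ax′ sr′ d)

module Derived (E : Ext) where

  wkˡ : ∀ {Γ} Δ → E ⊢ Γ → E ⊢ (Δ ++ Γ)
  wkˡ {Γ} Δ d = exch (++-comm Γ Δ) (wk d)

  swap₂ : ∀ {x y} → E ⊢ (x ∷ y ∷ []) → E ⊢ (y ∷ x ∷ [])
  swap₂ = exch (↭-swap _ _ ↭-refl)

  cut-with : ∀ {Γ Δ} C → E ⊢ (Γ ++ [ fm C ]) → E ⊢ (fm (neg C) ∷ Δ) → E ⊢ (Γ ++ Δ)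
  cut-with {Γ} {Δ} C d e =
    cut {Γ = Γ ++ Δ} C
      (exch (↭-trans (++-assoc Γ [ fm C ] Δ) (shift-last Γ (fm C) Δ)) (wk d))
      (exch (shift-last Γ (fm (neg C)) Δ) (wkˡ Γ e))

  box-r : ∀ t {Γ A} → E ⊢ (Γ ++ [ nest t [ fm A ] ]) → E ⊢ (Γ ++ [ fm (box t A) ])
  box-r future = □r
  box-r past   = ■r

  dia-r : ∀ t {Γ Δ A} → E ⊢ (Γ ++ [ nest t (Δ ++ [ fm A ]) ]) →
          E ⊢ (Γ ++ nest t Δ ∷ fm (dia t A) ∷ [])
  dia-r future = ◇r
  dia-r past   = ◆r

  resid : ∀ t {Γ Δ} → E ⊢ (Γ ++ [ nest t Δ ]) → E ⊢ (nest (converse t) Γ ∷ Δ)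
  resid future = rf
  resid past   = rp

  unresid : ∀ t {Γ Δ} → E ⊢ (nest (converse t) Γ ∷ Δ) → E ⊢ (Γ ++ [ nest t Δ ])
  unresid future {Γ} {Δ} d = exch (++-comm [ wh Δ ] Γ) (rp (exch (++-comm [ bl Γ ] Δ) d))
  unresid past   {Γ} {Δ} d = exch (++-comm [ bl Δ ] Γ) (rf (exch (++-comm [ wh Γ ] Δ) d))

  residⁿ : ∀ t n Γ Δ → E ⊢ (Γ ++ nestⁿ t n Δ) → E ⊢ (nestⁿ (converse t) n Γ ++ Δ)
  residⁿ t zero    Γ Δ d = d
  residⁿ t (suc n) Γ Δ d =
    subst (λ Θ → E ⊢ (Θ ++ Δ)) (nestⁿ-nest (converse t) n Γ)
      (residⁿ t n [ nest (converse t) Γ ] Δ (resid t d))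

  unresidⁿ : ∀ t n Γ Δ → E ⊢ (nestⁿ (converse t) n Γ ++ Δ) → E ⊢ (Γ ++ nestⁿ t n Δ)
  unresidⁿ t zero    Γ Δ d = d
  unresidⁿ t (suc n) Γ Δ d =
    unresid t (unresidⁿ t n [ nest (converse t) Γ ] Δ
      (subst (λ Θ → E ⊢ (Θ ++ Δ)) (sym (nestⁿ-nest (converse t) n Γ)) d))

  inside-nestⁿ : ∀ t n {Δ Δ′} → (∀ Θ → E ⊢ (Θ ++ Δ) → E ⊢ (Θ ++ Δ′)) →
                 ∀ Γ → E ⊢ (Γ ++ nestⁿ t n Δ) → E ⊢ (Γ ++ nestⁿ t n Δ′)
  inside-nestⁿ t n {Δ} {Δ′} f Γ d =
    unresidⁿ t n Γ Δ′ (f (nestⁿ (converse t) n Γ) (residⁿ t n Γ Δ d))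

  nest-wkⁿ : ∀ t n Γ {Δ} → E ⊢ Δ → E ⊢ (Γ ++ nestⁿ t n Δ)
  nest-wkⁿ t n Γ {Δ} d = unresidⁿ t n Γ Δ (wkˡ (nestⁿ (converse t) n Γ) d)

  dia-rⁿ : ∀ t n Δ B → E ⊢ (Δ ++ [ fm B ]) → E ⊢ (fm (iter n (dia t) B) ∷ nestⁿ t n Δ)
  dia-rⁿ t zero    Δ B d = exch (↭-sym (∷↭∷ʳ (fm B) Δ)) d
  dia-rⁿ t (suc n) Δ B d =
    swap₂ (dia-r t {Γ = []} (nest-wkⁿ t 1 [] (exch (∷↭∷ʳ _ _) (dia-rⁿ t n Δ B d))))

  box-identity : ∀ t A → E ⊢ (fm A ∷ fm (neg A) ∷ []) →
                 E ⊢ (fm (box t A) ∷ fm (dia t (neg A)) ∷ [])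
  box-identity t A d = swap₂ (box-r t {Γ = [ fm (dia t (neg A)) ]} (dia-rⁿ t 1 [ fm A ] (neg A) d))

  dia-identity : ∀ t A → E ⊢ (fm (neg A) ∷ fm A ∷ []) →
                 E ⊢ (fm (dia t A) ∷ fm (box t (neg A)) ∷ [])
  dia-identity t A d = box-r t {Γ = [ fm (dia t A) ]} (dia-rⁿ t 1 [ fm (neg A) ] A d)

  identity : ∀ A → E ⊢ (fm A ∷ fm (neg A) ∷ [])
  identity (atom a)  = id [] a
  identity (natom a) = swap₂ (id [] a)
  identity (A ∨̇ B)   =
    ∧r {Γ = [ fm (A ∨̇ B) ]}
      (swap₂ (∨r {Γ = [ fm (neg A) ]}
        (exch (↭-swap _ _ ↭-refl) (wk {Δ = [ fm B ]} (identity A)))))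
      (swap₂ (∨r {Γ = [ fm (neg B) ]}
        (exch (↭-trans (↭-swap _ _ ↭-refl) (↭-prep _ (↭-swap _ _ ↭-refl)))
          (wk {Δ = [ fm A ]} (identity B)))))
  identity (A ∧̇ B)   =
    swap₂ (∧r {Γ = [ fm (neg A ∨̇ neg B) ]}
      (swap₂ (∨r {Γ = [ fm A ]} (wk {Δ = [ fm (neg B) ]} (identity A))))
      (swap₂ (∨r {Γ = [ fm B ]}
        (exch (↭-prep _ (↭-swap _ _ ↭-refl)) (wk {Δ = [ fm (neg A) ]} (identity B))))))
  identity (□ A)     = box-identity future A (identity A)
  identity (■ A)     = box-identity past A (identity A)
  identity (◇ A)     = dia-identity future A (swap₂ (identity A))
  identity (◆ A)     = dia-identity past A (swap₂ (identity A))

  box-inv : ∀ t C Γ → E ⊢ (Γ ++ [ fm (box t C) ]) → E ⊢ (Γ ++ [ nest t [ fm C ] ])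
  box-inv t C Γ d =
    cut-with (box t C) d
      (subst (λ B → E ⊢ (fm B ∷ [ nest t [ fm C ] ])) (sym (neg-box t C))
        (dia-rⁿ t 1 [ fm C ] (neg C) (identity C)))

  box-rⁿ : ∀ t n B Γ → E ⊢ (Γ ++ nestⁿ t n [ fm B ]) → E ⊢ (Γ ++ [ fm (iter n (box t) B) ])
  box-rⁿ t zero    B Γ d = d
  box-rⁿ t (suc n) B Γ d = box-r t (inside-nestⁿ t 1 (box-rⁿ t n B) Γ d)

  box-invⁿ : ∀ t n B Γ → E ⊢ (Γ ++ [ fm (iter n (box t) B) ]) → E ⊢ (Γ ++ nestⁿ t n [ fm B ])
  box-invⁿ t zero    B Γ d = d
  box-invⁿ t (suc n) B Γ d = inside-nestⁿ t 1 (box-invⁿ t n B) Γ (box-inv t _ Γ d)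

  box-adjointⁿ : ∀ t n {A B} → E ⊢ (fm A ∷ fm (iter n (box t) B) ∷ []) →
                 E ⊢ (fm B ∷ fm (iter n (box (converse t)) A) ∷ [])
  box-adjointⁿ t n {A} {B} d =
    box-rⁿ (converse t) n A [ fm B ]
      (exch (++-comm (nestⁿ (converse t) n [ fm A ]) [ fm B ])
        (residⁿ t n [ fm A ] [ fm B ] (box-invⁿ t n B [ fm A ] d)))

  dia-unitⁿ : ∀ t n {A B} → E ⊢ (fm A ∷ fm B ∷ []) →
              E ⊢ (fm A ∷ nestⁿ t n [ fm (iter n (dia (converse t)) B) ])
  dia-unitⁿ t n {A} {B} d =
    unresidⁿ t n [ fm A ] _ (exch (∷↭∷ʳ _ _) (dia-rⁿ (converse t) n [ fm A ] B d))

  ◇ⁿ■ⁿ-elim : ∀ n D → E ⊢ (fm (neg (iter n ◇ (iter n ■ D))) ∷ fm D ∷ [])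
  ◇ⁿ■ⁿ-elim n D =
    subst (λ C → E ⊢ (fm C ∷ fm D ∷ [])) (sym (neg-iter² (neg-dia future) (neg-box past) n n D))
      (swap₂ (box-rⁿ future n _ [ fm D ] (dia-unitⁿ future n (identity D))))

  pack  : ∀ Δ Γ → E ⊢ (Γ ++ Δ) → E ⊢ (Γ ++ [ fm ⟦ Δ ⟧ ])
  packᵢ : ∀ x Γ → E ⊢ (Γ ++ [ x ]) → E ⊢ (Γ ++ [ fm ⟦ x ⟧ᵢ ])
  pack []       Γ d = wk (exch (++-identityʳ Γ) d)
  pack (x ∷ xs) Γ d =
    ∨r (exch (↭-trans (swap-last Γ _ _) (++-assoc Γ _ _))
      (packᵢ x (Γ ++ [ fm ⟦ xs ⟧ ])
        (exch (swap-last Γ x _)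
          (pack xs (Γ ++ [ x ]) (exch (↭-sym (++-assoc Γ [ x ] xs)) d)))))
  packᵢ (fm A) Γ d = d
  packᵢ (wh Δ) Γ d = box-r future (inside-nestⁿ future 1 (pack Δ) Γ d)
  packᵢ (bl Δ) Γ d = box-r past (inside-nestⁿ past 1 (pack Δ) Γ d)

  identity-⟦⟧  : ∀ Δ → E ⊢ (Δ ++ [ fm (neg ⟦ Δ ⟧) ])
  identity-⟦⟧ᵢ : ∀ x → E ⊢ (x ∷ fm (neg ⟦ x ⟧ᵢ) ∷ [])
  identity-⟦⟧ []       = ∨r {Γ = []} (swap₂ (id [] 0))
  identity-⟦⟧ (x ∷ xs) =
    ∧r {Γ = x ∷ xs}
      (exch (↭-prep x (∷↭∷ʳ _ xs)) (wk {Δ = xs} (identity-⟦⟧ᵢ x)))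
      (exch (↭-sym (∷↭∷ʳ x _)) (wk {Δ = [ x ]} (identity-⟦⟧ xs)))
  identity-⟦⟧ᵢ (fm A) = identity A
  identity-⟦⟧ᵢ (wh Δ) = dia-r future {Γ = []} (nest-wkⁿ future 1 [] (identity-⟦⟧ Δ))
  identity-⟦⟧ᵢ (bl Δ) = dia-r past {Γ = []} (nest-wkⁿ past 1 [] (identity-⟦⟧ Δ))

  unpack : ∀ Δ Γ → E ⊢ (Γ ++ [ fm ⟦ Δ ⟧ ]) → E ⊢ (Γ ++ Δ)
  unpack Δ Γ d = cut-with ⟦ Δ ⟧ d (exch (↭-sym (∷↭∷ʳ _ Δ)) (identity-⟦⟧ Δ))

module StructuralRulesDeriveAxioms (SL : SLSet) where
  open Derived (SKt+SL SL)

  sl-nestⁿ : ∀ {h i j k} → SL h i j k → ∀ Γ Δ →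
             SKt+SL SL ⊢ (Γ ++ nestⁿ future i (nestⁿ past k Δ)) →
             SKt+SL SL ⊢ (Γ ++ nestⁿ past h (nestⁿ future j Δ))
  sl-nestⁿ {h} {i} {j} {k} p Γ Δ d =
    subst (λ Θ → SKt+SL SL ⊢ (Γ ++ Θ)) (sym (bulⁿ-circⁿ h j Δ))
      (str (sl p Γ Δ) (subst (λ Θ → SKt+SL SL ⊢ (Γ ++ Θ)) (circⁿ-bulⁿ i k Δ) d))

  axiom-derivable : ∀ {Γ} → AxSLRule SL Γ → SKt+SL SL ⊢ Γ
  axiom-derivable (axG {h} {i} {j} {k} p A) =
    subst (λ C → SKt+SL SL ⊢ (fm C ∷ fm (iter j □ (iter k ◇ A)) ∷ []))
      (sym (neg-iter² (neg-dia future) (neg-box future) h i A))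
      (swap₂ (box-adjointⁿ past h ◇ⁱ¬A,■ʰ□ʲ◇ᵏA))
    where
    ¬A,•ᵏ◇ᵏA : SKt+SL SL ⊢ (fm (neg A) ∷ nestⁿ past k [ fm (iter k ◇ A) ])
    ¬A,•ᵏ◇ᵏA = dia-unitⁿ past k (swap₂ (identity A))

    ◇ⁱ¬A,∘ⁱ•ᵏ◇ᵏA : SKt+SL SL ⊢ (fm (iter i ◇ (neg A)) ∷
                                nestⁿ future i (nestⁿ past k [ fm (iter k ◇ A) ]))
    ◇ⁱ¬A,∘ⁱ•ᵏ◇ᵏA = dia-rⁿ future i _ (neg A) (exch (∷↭∷ʳ _ _) ¬A,•ᵏ◇ᵏA)

    ◇ⁱ¬A,■ʰ□ʲ◇ᵏA : SKt+SL SL ⊢ (fm (iter i ◇ (neg A)) ∷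
                                fm (iter h ■ (iter j □ (iter k ◇ A))) ∷ [])
    ◇ⁱ¬A,■ʰ□ʲ◇ᵏA =
      box-rⁿ past h _ [ fm (iter i ◇ (neg A)) ]
        (inside-nestⁿ past h (box-rⁿ future j _) [ fm (iter i ◇ (neg A)) ]
          (sl-nestⁿ p [ fm (iter i ◇ (neg A)) ] _ ◇ⁱ¬A,∘ⁱ•ᵏ◇ᵏA))

module AxiomsAdmitStructuralRules (SL : SLSet) where
  open Derived (SKt+AxSL SL)

  primitive-form : ∀ {h i j k} → SL h i j k → ∀ D →
                   SKt+AxSL SL ⊢ (fm (iter i ◇ (iter k ◆ (neg D))) ∷
                                  fm (iter h ■ (iter j □ D)) ∷ [])
  primitive-form {h} {i} {j} {k} p D =
    box-adjointⁿ future h (swap₂ (box-rⁿ future j D [ fm □ʰX ]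
      (inside-nestⁿ future j (λ Γ d → cut-with _ d (◇ⁿ■ⁿ-elim k D)) [ fm □ʰX ]
        (box-invⁿ future j _ [ fm □ʰX ] G-instance))))
    where
    □ʰX : Fm
    □ʰX = iter h □ (iter i ◇ (iter k ◆ (neg D)))

    neg-◇ʰ□ⁱ■ᵏD : neg (iter h ◇ (iter i □ (iter k ■ D))) ≡ □ʰX
    neg-◇ʰ□ⁱ■ᵏD = trans (neg-iter² (neg-dia future) (neg-box future) h i _)
                    (cong (λ C → iter h □ (iter i ◇ C)) (neg-iter (neg-box past) k D))

    G-instance : SKt+AxSL SL ⊢ (fm □ʰX ∷ fm (iter j □ (iter k ◇ (iter k ■ D))) ∷ [])
    G-instance =
      subst (λ C → SKt+AxSL SL ⊢ (fm C ∷ _)) neg-◇ʰ□ⁱ■ᵏD (ax (axG p (iter k ■ D)))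

  sl-admissible : ∀ {Γ Δ} → SLRule SL Γ Δ → SKt+AxSL SL ⊢ Γ → SKt+AxSL SL ⊢ Δ
  sl-admissible (sl {h} {i} {j} {k} p Γ Δ) d =
    subst (λ Θ → SKt+AxSL SL ⊢ (Γ ++ Θ)) (bulⁿ-circⁿ h j Δ)
      (inside-nestⁿ past h (inside-nestⁿ future j (unpack Δ)) Γ
        (inside-nestⁿ past h (box-invⁿ future j D) Γ (box-invⁿ past h _ Γ Γ,■ʰ□ʲD)))
    where
    D : Fm
    D = ⟦ Δ ⟧

    Γ,□ⁱ■ᵏD : SKt+AxSL SL ⊢ (Γ ++ [ fm (iter i □ (iter k ■ D)) ])
    Γ,□ⁱ■ᵏD =
      box-rⁿ future i _ Γ (inside-nestⁿ future i (box-rⁿ past k D) Γ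
        (inside-nestⁿ future i (inside-nestⁿ past k (pack Δ)) Γ
          (subst (λ Θ → SKt+AxSL SL ⊢ (Γ ++ Θ)) (sym (circⁿ-bulⁿ i k Δ)) d)))

    Γ,■ʰ□ʲD : SKt+AxSL SL ⊢ (Γ ++ [ fm (iter h ■ (iter j □ D)) ])
    Γ,■ʰ□ʲD =
      cut-with (iter i □ (iter k ■ D)) Γ,□ⁱ■ᵏD
        (subst (λ C → SKt+AxSL SL ⊢ (fm C ∷ fm (iter h ■ (iter j □ D)) ∷ []))
          (sym (neg-iter² (neg-box future) (neg-box past) i k D))
          (primitive-form p D))

proposition5p4 : (SL : SLSet) → (Γ : Seq) → ((SKt+AxSL SL ⊢ Γ → SKt+SL SL ⊢ Γ) × (SKt+SL SL ⊢ Γ → SKt+AxSL SL ⊢ Γ))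
proposition5p4 SL Γ =
  simulate (StructuralRulesDeriveAxioms.axiom-derivable SL) (λ ()) ,
  simulate (λ ()) (AxiomsAdmitStructuralRules.sl-admissible SL)
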